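{- Let $k\ge2$, let $\mathbf a=(a_1,\ldots,a_k)$ be a vector of positive integers with trace $\tau=\sum_j a_j$, and let $(A_n)_{n\ge1}$, $(B_n)_{n\ge1}$ be the associated anti-recurrence sequence and its complement. Then for every $n\ge1$, $A_{n+1}-A_n\ge k\tau$. This is an equality if the $B$-blocks generating $A_n$ and $A_{n+1}$ are both intervals of consecutive integers whose union is also an interval. In particular, the inequality is strict if one of these two $B$-blocks is an interval and the other is not.
   Context: Anti-recurrence sequence: $(A_n)_{n\ge1}$ and $(B_n)_{n\ge1}$ are the unique strictly increasing sequences of positive integers that are complementary (every positive integer lies in exactly one of them) and satisfy $A_n=\sum_{j=1}^k a_jB_{(n-1)k+j}$ for all $n\ge1$. The $B$-block generating $A_n$ is the set $\{B_{(n-1)k+1},\ldots,B_{nk}\}$. An interval is a set of consecutive integers $\{a,a+1,\ldots,b\}$. -}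

module Defs where

open import Data.Nat using (ℕ; zero; suc; _+_; _*_; _≤_; _<_)
open import Data.Fin using (Fin; toℕ)
import Data.Fin as F
open import Data.Product using (Σ; _×_)
open import Data.Sum using (_⊎_)
open import Relation.Nullary using (¬_)
open import Relation.Binary.PropositionalEquality using (_≡_)

∑ : ∀ {k} → (Fin k → ℕ) → ℕ
∑ {zero}  f = 0
∑ {suc k} f = f F.zero + ∑ (λ j → f (F.suc j))

-- Convention: sequences are 0-indexed, i.e. A i = A_{i+1}, B i = B_{i+1},
-- and a j = a_{j+1} for j : Fin k.

record IsAntiRecurrence (k : ℕ) (a : Fin k → ℕ) (A B : ℕ → ℕ) : Set where
  field
    A-pos   : ∀ n → 1 ≤ A n
    B-pos   : ∀ n → 1 ≤ B n
    A-incr  : ∀ n → A n < A (suc n)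
    B-incr  : ∀ n → B n < B (suc n)
    cover   : ∀ m → 1 ≤ m → (Σ ℕ λ n → A n ≡ m) ⊎ (Σ ℕ λ n → B n ≡ m)
    disjoint : ∀ m → ¬ ((Σ ℕ λ n → A n ≡ m) × (Σ ℕ λ n → B n ≡ m))
    recur   : ∀ n → A n ≡ ∑ (λ (j : Fin k) → a j * B (n * k + toℕ j))

-- The B-block generating A_{n+1} (0-indexed n): {B_{nk+1}, ..., B_{nk+k}} (1-indexed)
Block : (k : ℕ) → (B : ℕ → ℕ) → ℕ → ℕ → Set
Block k B n x = Σ (Fin k) λ j → B (n * k + toℕ j) ≡ x

IsInterval : (ℕ → Set) → Set
IsInterval S = Σ ℕ λ lo → Σ ℕ λ hi →
  ∀ x → (S x → lo ≤ x × x ≤ hi) × (lo ≤ x → x ≤ hi → S x)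

Union : (ℕ → Set) → (ℕ → Set) → ℕ → Set
Union S T x = S x ⊎ T x

-- B(i + K) ≥ B i + K for a strictly increasing B, so A_{n+1} − A_n = Σ_j a_j (B(i_j + K) − B(i_j))
-- is at least K τ, with equality exactly when every element of the n-th block is translated by K
-- into the (n+1)-st. A union of the two blocks that is an interval forces B to take unit steps
-- across both blocks, hence all translations are by K; conversely, translations by K force unit
-- steps within each block, so both blocks are intervals.
module Submission where

open import Defs
open import Data.Nat using (ℕ; zero; suc; _+_; _*_; _∸_; _≤_; _<_; z≤n; s≤s; s≤s⁻¹; >-nonZero)
open import Data.Nat.Properties
open import Algebra.Properties.Semiring.Sum +-*-semiring using (sum; sum-cong-≗; ∑-distrib-+; *-distribˡ-sum)
open import Data.Nat.Tactic.RingSolver using (solve-∀)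
open import Data.Fin using (Fin; toℕ; fromℕ; fromℕ<)
import Data.Fin as F
open import Data.Fin.Properties using (toℕ-fromℕ; toℕ-fromℕ<; toℕ≤pred[n])
open import Data.Product using (Σ; _×_; _,_; proj₁; proj₂)
open import Data.Sum using (_⊎_; inj₁; inj₂)
open import Function using (_∘_)
open import Relation.Nullary using (¬_; contradiction)
open import Relation.Binary.PropositionalEquality

∑≡sum : ∀ {k} (f : Fin k → ℕ) → ∑ f ≡ sum f
∑≡sum {zero}  f = refl
∑≡sum {suc k} f = cong (f F.zero +_) (∑≡sum (f ∘ F.suc))

∑-cong : ∀ {k} {f g : Fin k → ℕ} → (∀ j → f j ≡ g j) → ∑ f ≡ ∑ g
∑-cong {f = f} {g} f≗g = trans (∑≡sum f) (trans (sum-cong-≗ f≗g) (sym (∑≡sum g)))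

*-∑-+-∑ : ∀ {k} c (f g : Fin k → ℕ) → c * ∑ f + ∑ g ≡ ∑ (λ j → c * f j + g j)
*-∑-+-∑ c f g = begin
  c * ∑ f + ∑ g                ≡⟨ cong₂ (λ x y → c * x + y) (∑≡sum f) (∑≡sum g) ⟩
  c * sum f + sum g            ≡⟨ cong (_+ sum g) (*-distribˡ-sum c f) ⟩
  sum ((c *_) ∘ f) + sum g     ≡⟨ ∑-distrib-+ ((c *_) ∘ f) g ⟨
  sum (λ j → c * f j + g j)    ≡⟨ ∑≡sum (λ j → c * f j + g j) ⟨
  ∑ (λ j → c * f j + g j)      ∎
  where open ≡-Reasoning

∑-mono-≤ : ∀ {k} {f g : Fin k → ℕ} → (∀ j → f j ≤ g j) → ∑ f ≤ ∑ g
∑-mono-≤ {zero}  f≤g = z≤n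
∑-mono-≤ {suc k} f≤g = +-mono-≤ (f≤g F.zero) (∑-mono-≤ (f≤g ∘ F.suc))

∑-mono-< : ∀ {k} {f g : Fin k → ℕ} → (∀ j → f j ≤ g j) → ∀ i → f i < g i → ∑ f < ∑ g
∑-mono-< f≤g F.zero    fi<gi = +-mono-<-≤ fi<gi (∑-mono-≤ (f≤g ∘ F.suc))
∑-mono-< f≤g (F.suc i) fi<gi = +-mono-≤-< (f≤g F.zero) (∑-mono-< (f≤g ∘ F.suc) i fi<gi)

∑-mono-≤-≡ : ∀ {k} {f g : Fin k → ℕ} → (∀ j → f j ≤ g j) → ∑ f ≡ ∑ g → ∀ j → f j ≡ g j
∑-mono-≤-≡ f≤g ∑f≡∑g j with m≤n⇒m<n∨m≡n (f≤g j)
... | inj₁ fj<gj = contradiction ∑f≡∑g (<⇒≢ (∑-mono-< f≤g j fj<gj))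
... | inj₂ fj≡gj = fj≡gj

IsInterval-convex : ∀ {S : ℕ → Set} → IsInterval S → ∀ {x y z} → S x → S y → x ≤ z → z ≤ y → S z
IsInterval-convex (_ , _ , bounds) Sx Sy x≤z z≤y =
  proj₂ (bounds _) (≤-trans (proj₁ (proj₁ (bounds _) Sx)) x≤z) (≤-trans z≤y (proj₂ (proj₁ (bounds _) Sy)))

module StrictlyIncreasing (B : ℕ → ℕ) (B-incr : ∀ n → B n < B (suc n)) where

  B[m]+d≤B[m+d] : ∀ m d → B m + d ≤ B (m + d)
  B[m]+d≤B[m+d] m zero    rewrite +-identityʳ (B m) | +-identityʳ m = ≤-refl
  B[m]+d≤B[m+d] m (suc d) rewrite +-suc (B m) d | +-suc m d = ≤-trans (s≤s (B[m]+d≤B[m+d] m d)) (B-incr (m + d))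

  B-mono-≤ : ∀ {i j} → i ≤ j → B i ≤ B j
  B-mono-≤ {i} i≤j = begin
    B i                ≤⟨ m≤m+n (B i) _ ⟩
    B i + (_ ∸ i)      ≤⟨ B[m]+d≤B[m+d] i _ ⟩
    B (i + (_ ∸ i))    ≡⟨ cong B (m+[n∸m]≡n i≤j) ⟩
    B _                ∎
    where open ≤-Reasoning

  B-cancel-< : ∀ {i j} → B i < B j → i < j
  B-cancel-< Bi<Bj = ≰⇒> (λ j≤i → <⇒≱ Bi<Bj (B-mono-≤ j≤i))

  UnitSteps : ℕ → ℕ → Set
  UnitSteps m d = ∀ i → i < d → B (suc (m + i)) ≡ suc (B (m + i))

  UnitSteps-≤ : ∀ {m d e} → e ≤ d → UnitSteps m d → UnitSteps m e
  UnitSteps-≤ e≤d steps i i<e = steps i (<-≤-trans i<e e≤d)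

  UnitSteps-shift : ∀ {m} i {e} → UnitSteps m (i + e) → UnitSteps (m + i) e
  UnitSteps-shift {m} i steps j j<e =
    subst (λ p → B (suc p) ≡ suc (B p)) (sym (+-assoc m i j)) (steps (i + j) (+-monoʳ-< i j<e))

  UnitSteps⇒B[m+i]≡B[m]+i : ∀ {m d} → UnitSteps m d → ∀ i → i ≤ d → B (m + i) ≡ B m + i
  UnitSteps⇒B[m+i]≡B[m]+i {m} steps zero    _     = trans (cong B (+-identityʳ m)) (sym (+-identityʳ (B m)))
  UnitSteps⇒B[m+i]≡B[m]+i {m} steps (suc i) 1+i≤d = begin
    B (m + suc i)    ≡⟨ cong B (+-suc m i) ⟩
    B (suc (m + i))  ≡⟨ steps i 1+i≤d ⟩
    suc (B (m + i))  ≡⟨ cong suc (UnitSteps⇒B[m+i]≡B[m]+i steps i (<⇒≤ 1+i≤d)) ⟩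
    suc (B m + i)    ≡⟨ +-suc (B m) i ⟨
    B m + suc i      ∎
    where open ≡-Reasoning

  UnitSteps-snoc : ∀ {m d} → UnitSteps m d → B (suc (m + d)) ≡ suc (B (m + d)) → UnitSteps m (suc d)
  UnitSteps-snoc steps last-step i i<1+d with m<1+n⇒m<n∨m≡n i<1+d
  ... | inj₁ i<d  = steps i i<d
  ... | inj₂ refl = last-step

  -- Each of the d steps is at least 1, so a total rise of exactly d leaves no room for a larger one.
  B[m+d]≡B[m]+d⇒UnitSteps : ∀ m d → B (m + d) ≡ B m + d → UnitSteps m d
  B[m+d]≡B[m]+d⇒UnitSteps m zero    _    i ()
  B[m+d]≡B[m]+d⇒UnitSteps m (suc d) rise =
    UnitSteps-snoc (B[m+d]≡B[m]+d⇒UnitSteps m d B[m+d]≡) (trans B[m+d+1]≡ (cong suc (sym B[m+d]≡)))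
    where
    B[m+d+1]≡ : B (suc (m + d)) ≡ suc (B m + d)
    B[m+d+1]≡ = trans (cong B (sym (+-suc m d))) (trans rise (+-suc (B m) d))
    B[m+d]≡ : B (m + d) ≡ B m + d
    B[m+d]≡ = ≤-antisym (s≤s⁻¹ (≤-trans (B-incr (m + d)) (≤-reflexive B[m+d+1]≡))) (B[m]+d≤B[m+d] m d)

  unit-step : ∀ {p q} → B q ≡ suc (B p) → B (suc p) ≡ suc (B p)
  unit-step {p} Bq≡ = ≤-antisym (≤-trans (B-mono-≤ (B-cancel-< (≤-reflexive (sym Bq≡)))) (≤-reflexive Bq≡))
                                (B-incr p)

  range-closed⇒UnitSteps : ∀ m d → (∀ x → B m ≤ x → x ≤ B (m + d) → Σ ℕ λ q → B q ≡ x) → UnitSteps m d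
  range-closed⇒UnitSteps m d closed i i<d = unit-step (proj₂ (closed _ Bm≤ ≤B[m+d]))
    where
    Bm≤ : B m ≤ suc (B (m + i))
    Bm≤ = ≤-trans (B-mono-≤ (m≤m+n m i)) (n≤1+n _)
    ≤B[m+d] : suc (B (m + i)) ≤ B (m + d)
    ≤B[m+d] = ≤-trans (B-incr (m + i)) (B-mono-≤ (≤-trans (≤-reflexive (sym (+-suc m i))) (+-monoʳ-≤ m i<d)))

  UnitSteps⇒IsInterval : ∀ {m d} → UnitSteps m d → IsInterval (λ x → Σ (Fin (suc d)) λ j → B (m + toℕ j) ≡ x)
  UnitSteps⇒IsInterval {m} {d} steps = B m , B m + d , λ x → bounds x , member x
    where
    B[m+i]≡ : ∀ i → i ≤ d → B (m + i) ≡ B m + i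
    B[m+i]≡ = UnitSteps⇒B[m+i]≡B[m]+i steps
    bounds : ∀ x → Σ (Fin (suc d)) (λ j → B (m + toℕ j) ≡ x) → B m ≤ x × x ≤ B m + d
    bounds x (j , refl) = subst (B m ≤_) (sym (B[m+i]≡ _ (toℕ≤pred[n] j))) (m≤m+n (B m) (toℕ j))
                        , subst (_≤ B m + d) (sym (B[m+i]≡ _ (toℕ≤pred[n] j))) (+-monoʳ-≤ (B m) (toℕ≤pred[n] j))
    member : ∀ x → B m ≤ x → x ≤ B m + d → Σ (Fin (suc d)) λ j → B (m + toℕ j) ≡ x
    member x Bm≤x x≤ = fromℕ< (s≤s i≤d) , trans (cong (λ t → B (m + t)) (toℕ-fromℕ< (s≤s i≤d)))
                                                (trans (B[m+i]≡ _ i≤d) (m+[n∸m]≡n Bm≤x))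
      where
      i≤d : x ∸ B m ≤ d
      i≤d = ≤-trans (∸-monoˡ-≤ (B m) x≤) (≤-reflexive (m+n∸m≡n (B m) d))

module ConsecutiveBlocks {k'} {a : Fin (suc k') → ℕ} {A B : ℕ → ℕ}
                         (ar : IsAntiRecurrence (suc k') a A B) (n : ℕ) where

  open IsAntiRecurrence ar
  open StrictlyIncreasing B B-incr

  K m : ℕ
  K = suc k'
  m = n * K

  Translated : Set
  Translated = ∀ (j : Fin K) → B (m + toℕ j + K) ≡ B (m + toℕ j) + K

  A[n+1]≡ : A (suc n) ≡ ∑ (λ j → a j * B (m + toℕ j + K))
  A[n+1]≡ = trans (recur (suc n)) (∑-cong λ j → cong (λ i → a j * B i) (index-shift K m (toℕ j)))
    where
    index-shift : ∀ K m t → K + m + t ≡ m + t + K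
    index-shift = solve-∀

  K*τ+A[n]≡ : K * ∑ a + A n ≡ ∑ (λ j → a j * (B (m + toℕ j) + K))
  K*τ+A[n]≡ = trans (cong (K * ∑ a +_) (recur n))
                    (trans (*-∑-+-∑ K a (λ j → a j * B (m + toℕ j))) (∑-cong λ j → distrib K (a j) (B (m + toℕ j))))
    where
    distrib : ∀ c x y → c * x + x * y ≡ x * (y + c)
    distrib = solve-∀

  translate-≤ : ∀ j → a j * (B (m + toℕ j) + K) ≤ a j * B (m + toℕ j + K)
  translate-≤ j = *-monoʳ-≤ (a j) (B[m]+d≤B[m+d] (m + toℕ j) K)

  K*τ+A[n]≤A[n+1] : K * ∑ a + A n ≤ A (suc n)
  K*τ+A[n]≤A[n+1] = subst₂ _≤_ (sym K*τ+A[n]≡) (sym A[n+1]≡) (∑-mono-≤ translate-≤)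

  Translated⇒A[n+1]≡K*τ+A[n] : Translated → A (suc n) ≡ K * ∑ a + A n
  Translated⇒A[n+1]≡K*τ+A[n] translated =
    trans A[n+1]≡ (sym (trans K*τ+A[n]≡ (∑-cong λ j → cong (a j *_) (sym (translated j)))))

  K*τ+A[n]≡A[n+1]⇒Translated : (∀ j → 1 ≤ a j) → K * ∑ a + A n ≡ A (suc n) → Translated
  K*τ+A[n]≡A[n+1]⇒Translated a-pos eq j =
    sym (*-cancelˡ-≡ _ _ (a j) {{>-nonZero (a-pos j)}} (∑-mono-≤-≡ translate-≤ ∑≡∑ j))
    where
    ∑≡∑ : ∑ (λ j → a j * (B (m + toℕ j) + K)) ≡ ∑ (λ j → a j * B (m + toℕ j + K))
    ∑≡∑ = trans (sym K*τ+A[n]≡) (trans eq A[n+1]≡)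

  UnitSteps-across-blocks⇒Translated : UnitSteps m (k' + K) → Translated
  UnitSteps-across-blocks⇒Translated steps j = begin
    B (m + t + K)      ≡⟨ cong B (+-assoc m t K) ⟩
    B (m + (t + K))    ≡⟨ B[m+i]≡ (t + K) (+-monoˡ-≤ K (toℕ≤pred[n] j)) ⟩
    B m + (t + K)      ≡⟨ +-assoc (B m) t K ⟨
    B m + t + K        ≡⟨ cong (_+ K) (B[m+i]≡ t (≤-trans (toℕ≤pred[n] j) (m≤m+n k' K))) ⟨
    B (m + t) + K      ∎
    where
    open ≡-Reasoning
    t = toℕ j
    B[m+i]≡ : ∀ i → i ≤ k' + K → B (m + i) ≡ B m + i
    B[m+i]≡ = UnitSteps⇒B[m+i]≡B[m]+i steps

  Union-interval⇒UnitSteps : IsInterval (Union (Block K B n) (Block K B (suc n))) → UnitSteps m (k' + K)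
  Union-interval⇒UnitSteps union-interval = range-closed⇒UnitSteps m (k' + K) closed
    where
    last-index : K + m + toℕ (fromℕ k') ≡ m + (k' + K)
    last-index = trans (cong (K + m +_) (toℕ-fromℕ k')) (reassoc K m k')
      where
      reassoc : ∀ K m k → K + m + k ≡ m + (k + K)
      reassoc = solve-∀
    closed : ∀ x → B m ≤ x → x ≤ B (m + (k' + K)) → Σ ℕ λ q → B q ≡ x
    closed x Bm≤x x≤B[last] with IsInterval-convex union-interval (inj₁ (F.zero , refl)) (inj₂ (fromℕ k' , refl))
                                   (subst (λ i → B i ≤ x) (sym (+-identityʳ m)) Bm≤x)
                                   (subst (λ i → x ≤ B i) (sym last-index) x≤B[last])
    ... | inj₁ (i , Bi≡x) = m + toℕ i , Bi≡x
    ... | inj₂ (i , Bi≡x) = K + m + toℕ i , Bi≡x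

  -- Translating the first element of the n-th block spans the n-th block with unit steps,
  -- translating its last element spans the (n+1)-st.
  Translated⇒blocks-interval : Translated → IsInterval (Block K B n) × IsInterval (Block K B (suc n))
  Translated⇒blocks-interval translated =
      UnitSteps⇒IsInterval (UnitSteps-≤ (n≤1+n k') (subst (λ i → UnitSteps i K) (+-identityʳ m) from-first))
    , UnitSteps⇒IsInterval (subst (λ i → UnitSteps i k') (next-block m k') (UnitSteps-shift 1 from-last))
    where
    from-first : UnitSteps (m + 0) K
    from-first = B[m+d]≡B[m]+d⇒UnitSteps (m + 0) K (translated F.zero)
    from-last : UnitSteps (m + k') K
    from-last = B[m+d]≡B[m]+d⇒UnitSteps (m + k') K
      (subst (λ t → B (m + t + K) ≡ B (m + t) + K) (toℕ-fromℕ k') (translated (fromℕ k')))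
    next-block : ∀ m k → m + k + 1 ≡ suc k + m
    next-block = solve-∀

lemma2 : (k : ℕ) → 2 ≤ k → (a : Fin k → ℕ) → (∀ j → 1 ≤ a j) →
    (A B : ℕ → ℕ) → IsAntiRecurrence k a A B →
    ∀ n →
      (k * ∑ a + A n ≤ A (suc n))
      × ((IsInterval (Block k B n) → IsInterval (Block k B (suc n)) →
          IsInterval (Union (Block k B n) (Block k B (suc n))) →
          A (suc n) ≡ k * ∑ a + A n)
      × ((IsInterval (Block k B n) × ¬ IsInterval (Block k B (suc n)))
          ⊎ (¬ IsInterval (Block k B n) × IsInterval (Block k B (suc n))) →
          k * ∑ a + A n < A (suc n)))
lemma2 (suc k') (s≤s _) a a-pos A B ar n =
    K*τ+A[n]≤A[n+1]
  , (λ _ _ union-interval →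
      Translated⇒A[n+1]≡K*τ+A[n] (UnitSteps-across-blocks⇒Translated (Union-interval⇒UnitSteps union-interval)))
  , λ exactly-one → ≤∧≢⇒< K*τ+A[n]≤A[n+1] λ eq →
      both-not-exactly-one (Translated⇒blocks-interval (K*τ+A[n]≡A[n+1]⇒Translated a-pos eq)) exactly-one
  where
  open ConsecutiveBlocks ar n
  both-not-exactly-one : ∀ {P Q : Set} → P × Q → ¬ ((P × ¬ Q) ⊎ (¬ P × Q))
  both-not-exactly-one (p , q) (inj₁ (_ , ¬q)) = ¬q q
  both-not-exactly-one (p , q) (inj₂ (¬p , _)) = ¬p p
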